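{- Let $X=\prod_{i=1}^n\{0,\dots,m_i\}$, $f\colon X\to X$, and $f^b=\beta\circ f\circ\beta^{ -1}\colon\mathcal{A}\to\mathcal{A}$. For $x,y\in X$, the pair $x,y$ is a mirror pair for $f$ if and only if $\beta(x),\beta(y)$ is a mirror pair for $f^b$.
   Context: $m_i\ge1$, $m=\sum_i m_i$; coordinates of $\{0,1\}^m$ are indexed by $I=\{(i,j)\mid 1\le i\le n,\,1\le j\le m_i\}$. $\beta\colon X\to\{0,1\}^m$ is given by $\beta_{i,j}(x)=1$ iff $x_i\ge j$; $\mathcal{A}=\beta(X)$. For a map $g\colon Y\to Y$, where $Y$ is a set of integer vectors with coordinates indexed by a finite set $J$, and $x,y\in Y$, let $I(x,y)=\{k\in J\mid x_k\ne y_k\}$. A pair of distinct states $x,y\in Y$ is a mirror pair for $g$ if for every $k\in I(x,y)$ either $g_k(x)\le x_k,y_k\le g_k(y)$ or $g_k(y)\le x_k,y_k\le g_k(x)$ (for Boolean maps this means $g_k(x)\ne g_k(y)$ for all $k\in I(x,y)$). -}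

module Defs where

open import Data.Nat using (ℕ; suc; _≤_; _<_)
open import Data.Nat.Properties using (_<?_)
open import Data.Fin using (Fin; toℕ)
open import Data.Bool using (Bool; true; false)
open import Data.Product using (Σ; _×_; _,_; ∃; proj₁; proj₂)
open import Data.Sum using (_⊎_)
open import Relation.Nullary using (¬_)
open import Relation.Nullary.Decidable using (⌊_⌋)
open import Relation.Binary.PropositionalEquality using (_≡_; refl)

-- I(x,y) = { k | coord x k ≢ coord y k }; "distinct" means I(x,y) ≠ ∅.
MirrorPair : {Y J : Set} → (coord : Y → J → ℕ) → (g : Y → Y) → Y → Y → Set
MirrorPair {Y} {J} coord g x y =
  (∃ λ (k : J) → ¬ (coord x k ≡ coord y k)) ×
  (∀ (k : J) → ¬ (coord x k ≡ coord y k) →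
     (  (coord (g x) k ≤ coord x k × coord (g x) k ≤ coord y k
         × coord x k ≤ coord (g y) k × coord y k ≤ coord (g y) k)
     ⊎  (coord (g y) k ≤ coord x k × coord (g y) k ≤ coord y k
         × coord x k ≤ coord (g x) k × coord y k ≤ coord (g x) k)))

module _ {n : ℕ} (m : Fin n → ℕ) where

  X : Set
  X = (i : Fin n) → Fin (suc (m i))

  coordX : X → Fin n → ℕ
  coordX x i = toℕ (x i)

  -- Index set I = {(i,j) | 1 ≤ j ≤ m_i}; j ∈ {1..m_i} is represented by
  -- j' : Fin (m i) with j = toℕ j' + 1.
  I : Set
  I = Σ (Fin n) (λ i → Fin (m i))

  -- β_{i,j}(x) = 1 iff x_i ≥ j, i.e. toℕ j' < x_i
  β : X → I → Bool
  β x (i , j) = ⌊ toℕ j <? toℕ (x i) ⌋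

  bit : Bool → ℕ
  bit true = 1
  bit false = 0

  -- 𝒜 = β(X): Boolean vectors together with a preimage under β.
  𝒜 : Set
  𝒜 = Σ (I → Bool) (λ b → Σ X (λ x → ∀ k → β x k ≡ b k))

  coord𝒜 : 𝒜 → I → ℕ
  coord𝒜 a k = bit (proj₁ a k)

  βA : X → 𝒜
  βA x = β x , x , (λ _ → refl)

  -- β⁻¹ : 𝒜 → X (β is injective, so the preimage is unique)
  β⁻¹ : 𝒜 → X
  β⁻¹ a = proj₁ (proj₂ a)

  fᵇ : (X → X) → 𝒜 → 𝒜
  fᵇ f a = βA (f (β⁻¹ a))

-- A coordinate x_i is recorded by β as the thermometer code of its value: bit (i,j) says
-- whether x_i exceeds j. Two values a ≠ b differ exactly at the thresholds j with
-- min a b ≤ j < max a b, and the images fa, fb enclose a and b exactly when every such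
-- threshold also separates fa from fb; by monotonicity it suffices to test the two
-- extreme thresholds min a b and max a b − 1. For Boolean values, enclosing a differing
-- pair simply means being distinct.
module Submission where

open import Defs
open import Data.Bool using (Bool; true; false)
open import Data.Nat using (ℕ; suc; _≤_; _<_; z≤n; s≤s)
open import Data.Nat.Properties
open import Data.Fin using (Fin; toℕ; fromℕ<)
open import Data.Fin.Properties using (toℕ≤pred[n]; toℕ-fromℕ<)
open import Data.Product using (_×_; _,_; ∃; proj₂)
open import Data.Sum using (_⊎_; inj₁; inj₂)
open import Function using (_∘_)
open import Relation.Binary.Definitions using (tri<; tri≈; tri>)
open import Relation.Binary.PropositionalEquality
open import Relation.Nullary using (yes; no; contradiction)
open import Relation.Nullary.Decidable using (⌊_⌋)

Enclosing : ℕ → ℕ → ℕ → ℕ → Set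
Enclosing a b u v = (u ≤ a × u ≤ b × a ≤ v × b ≤ v) ⊎ (v ≤ a × v ≤ b × a ≤ u × b ≤ u)

Enclosing-sym : ∀ {a b u v} → Enclosing a b u v → Enclosing b a u v
Enclosing-sym (inj₁ (u≤a , u≤b , a≤v , b≤v)) = inj₁ (u≤b , u≤a , b≤v , a≤v)
Enclosing-sym (inj₂ (v≤a , v≤b , a≤u , b≤u)) = inj₂ (v≤b , v≤a , b≤u , a≤u)

Enclosing-by-equal⇒≡ : ∀ {a b w} → Enclosing a b w w → a ≡ b
Enclosing-by-equal⇒≡ (inj₁ (w≤a , w≤b , a≤w , b≤w)) = trans (≤-antisym a≤w w≤a) (≤-antisym w≤b b≤w)
Enclosing-by-equal⇒≡ (inj₂ (w≤a , w≤b , a≤w , b≤w)) = trans (≤-antisym a≤w w≤a) (≤-antisym w≤b b≤w)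

exceeds : ℕ → ℕ → Bool
exceeds j a = ⌊ j <? a ⌋

Separates : ℕ → ℕ → ℕ → Set
Separates j a b = (a ≤ j × j < b) ⊎ (b ≤ j × j < a)

Separates⇒exceeds≢ : ∀ {j a b} → Separates j a b → exceeds j a ≢ exceeds j b
Separates⇒exceeds≢ {j} {a} {b} (inj₁ (a≤j , j<b)) with j <? a | j <? b
... | yes j<a | _       = contradiction j<a (≤⇒≯ a≤j)
... | no  _   | yes _   = λ ()
... | no  _   | no  j≮b = contradiction j<b j≮b
Separates⇒exceeds≢ (inj₂ separates) = Separates⇒exceeds≢ (inj₁ separates) ∘ sym

exceeds≢⇒Separates : ∀ {j a b} → exceeds j a ≢ exceeds j b → Separates j a b
exceeds≢⇒Separates {j} {a} {b} ne with j <? a | j <? b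
... | yes j<a | no  j≮b = inj₂ (≮⇒≥ j≮b , j<a)
... | no  j≮a | yes j<b = inj₁ (≮⇒≥ j≮a , j<b)
... | yes _   | yes _   = contradiction refl ne
... | no  _   | no  _   = contradiction refl ne

Separates⇒∃exceeds≢ : ∀ {M j a b} → j < M → Separates j a b → ∃ λ (k : Fin M) → exceeds (toℕ k) a ≢ exceeds (toℕ k) b
Separates⇒∃exceeds≢ {a = a} {b} j<M sep =
  fromℕ< j<M , subst (λ k → exceeds k a ≢ exceeds k b) (sym (toℕ-fromℕ< j<M)) (Separates⇒exceeds≢ sep)

≢⇒∃exceeds≢ : ∀ {M a b} → a ≤ M → b ≤ M → a ≢ b → ∃ λ (j : Fin M) → exceeds (toℕ j) a ≢ exceeds (toℕ j) b
≢⇒∃exceeds≢ {a = a} {b} a≤M b≤M a≢b with <-cmp a b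
... | tri< a<b _ _ = Separates⇒∃exceeds≢ (<-≤-trans a<b b≤M) (inj₁ (≤-refl , a<b))
... | tri≈ _ a≡b _ = contradiction a≡b a≢b
... | tri> _ _ b<a = Separates⇒∃exceeds≢ (<-≤-trans b<a a≤M) (inj₂ (≤-refl , b<a))

Enclosing⇒Separates : ∀ {j a b u v} → Enclosing a b u v → Separates j a b → Separates j u v
Enclosing⇒Separates (inj₁ (u≤a , _ , _ , b≤v)) (inj₁ (a≤j , j<b)) = inj₁ (≤-trans u≤a a≤j , <-≤-trans j<b b≤v)
Enclosing⇒Separates (inj₂ (v≤a , _ , _ , b≤u)) (inj₁ (a≤j , j<b)) = inj₂ (≤-trans v≤a a≤j , <-≤-trans j<b b≤u)
Enclosing⇒Separates (inj₁ (_ , u≤b , a≤v , _)) (inj₂ (b≤j , j<a)) = inj₁ (≤-trans u≤b b≤j , <-≤-trans j<a a≤v)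
Enclosing⇒Separates (inj₂ (_ , v≤b , a≤u , _)) (inj₂ (b≤j , j<a)) = inj₂ (≤-trans v≤b b≤j , <-≤-trans j<a a≤u)

Separates-ends⇒Enclosing : ∀ {a c u v} → a ≤ c → Separates a u v → Separates c u v → Enclosing a (suc c) u v
Separates-ends⇒Enclosing a≤c (inj₁ (u≤a , a<v)) (inj₁ (_ , c<v)) = inj₁ (u≤a , m≤n⇒m≤1+n (≤-trans u≤a a≤c) , <⇒≤ a<v , c<v)
Separates-ends⇒Enclosing a≤c (inj₂ (v≤a , a<u)) (inj₂ (_ , c<u)) = inj₂ (v≤a , m≤n⇒m≤1+n (≤-trans v≤a a≤c) , <⇒≤ a<u , c<u)
Separates-ends⇒Enclosing a≤c (inj₁ (u≤a , _)) (inj₂ (_ , c<u)) = contradiction (≤-trans u≤a a≤c) (<⇒≱ c<u)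
Separates-ends⇒Enclosing a≤c (inj₂ (v≤a , _)) (inj₁ (_ , c<v)) = contradiction (≤-trans v≤a a≤c) (<⇒≱ c<v)

module _ {M u v : ℕ} where

  ThresholdsSeparate : ℕ → ℕ → Set
  ThresholdsSeparate a b = (j : Fin M) → exceeds (toℕ j) a ≢ exceeds (toℕ j) b → exceeds (toℕ j) u ≢ exceeds (toℕ j) v

  ThresholdsSeparate-sym : ∀ {a b} → ThresholdsSeparate a b → ThresholdsSeparate b a
  ThresholdsSeparate-sym H j = H j ∘ ≢-sym

  Enclosing⇒ThresholdsSeparate : ∀ {a b} → (a ≢ b → Enclosing a b u v) → ThresholdsSeparate a b
  Enclosing⇒ThresholdsSeparate enc j ne =
    Separates⇒exceeds≢ (Enclosing⇒Separates (enc (ne ∘ cong (exceeds (toℕ j)))) (exceeds≢⇒Separates ne))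

  <-ThresholdsSeparate⇒Enclosing : ∀ {a b} → b ≤ M → a < b → ThresholdsSeparate a b → Enclosing a b u v
  <-ThresholdsSeparate⇒Enclosing {a} {suc c} b≤M (s≤s a≤c) H =
    Separates-ends⇒Enclosing a≤c (separatesAt ≤-refl a≤c) (separatesAt a≤c ≤-refl)
    where
    separatesAt : ∀ {j} → a ≤ j → j ≤ c → Separates j u v
    separatesAt {j} a≤j j≤c = subst (λ k → Separates k u v) (toℕ-fromℕ< j<M)
      (exceeds≢⇒Separates (H (fromℕ< j<M) (proj₂ (Separates⇒∃exceeds≢ j<M (inj₁ (a≤j , s≤s j≤c))))))
      where j<M = <-≤-trans (s≤s j≤c) b≤M

  ThresholdsSeparate⇒Enclosing : ∀ {a b} → a ≤ M → b ≤ M → ThresholdsSeparate a b → a ≢ b → Enclosing a b u v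
  ThresholdsSeparate⇒Enclosing {a} {b} a≤M b≤M H a≢b with <-cmp a b
  ... | tri< a<b _ _ = <-ThresholdsSeparate⇒Enclosing b≤M a<b H
  ... | tri≈ _ a≡b _ = contradiction a≡b a≢b
  ... | tri> _ _ b<a = Enclosing-sym (<-ThresholdsSeparate⇒Enclosing a≤M b<a (ThresholdsSeparate-sym H))

module _ {n : ℕ} (m : Fin n → ℕ) where

  bit-injective : ∀ {p q} → bit m p ≡ bit m q → p ≡ q
  bit-injective {false} {false} _ = refl
  bit-injective {true}  {true}  _ = refl

  bit≤1 : ∀ p → bit m p ≤ 1
  bit≤1 false = z≤n
  bit≤1 true  = s≤s z≤n

  ≢⇒Enclosing-bits : ∀ {u v} p q → u ≢ v → Enclosing (bit m p) (bit m q) (bit m u) (bit m v)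
  ≢⇒Enclosing-bits {false} {true}  p q _ = inj₁ (z≤n , z≤n , bit≤1 p , bit≤1 q)
  ≢⇒Enclosing-bits {true}  {false} p q _ = inj₂ (z≤n , z≤n , bit≤1 p , bit≤1 q)
  ≢⇒Enclosing-bits {false} {false} p q u≢v = contradiction refl u≢v
  ≢⇒Enclosing-bits {true}  {true}  p q u≢v = contradiction refl u≢v

  Enclosing-bits⇒≢ : ∀ {p q u v} → p ≢ q → Enclosing (bit m p) (bit m q) (bit m u) (bit m v) → u ≢ v
  Enclosing-bits⇒≢ p≢q enc refl = p≢q (bit-injective (Enclosing-by-equal⇒≡ enc))

  coordX≤m : (x : X m) (i : Fin n) → coordX m x i ≤ m i
  coordX≤m x i = toℕ≤pred[n] (x i)

lemma5 : (n : ℕ) (m : Fin n → ℕ) → (∀ i → 1 ≤ m i) →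
         (f : X m → X m) (x y : X m) →
         (MirrorPair (coordX m) f x y → MirrorPair (coord𝒜 m) (fᵇ m f) (βA m x) (βA m y))
         × (MirrorPair (coord𝒜 m) (fᵇ m f) (βA m x) (βA m y) → MirrorPair (coordX m) f x y)
lemma5 n m _ f x y = to , from
  where
  to : MirrorPair (coordX m) f x y → MirrorPair (coord𝒜 m) (fᵇ m f) (βA m x) (βA m y)
  to ((i , xᵢ≢yᵢ) , enc) with ≢⇒∃exceeds≢ (coordX≤m m x i) (coordX≤m m y i) xᵢ≢yᵢ
  ... | j , differ = ((i , j) , differ ∘ bit-injective m) , λ where
    (i , j) bits≢ → ≢⇒Enclosing-bits m _ _
      (Enclosing⇒ThresholdsSeparate (enc i) j (bits≢ ∘ cong (bit m)))

  from : MirrorPair (coord𝒜 m) (fᵇ m f) (βA m x) (βA m y) → MirrorPair (coordX m) f x y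
  from (((i , j) , bits≢) , enc) =
    (i , bits≢ ∘ cong (bit m ∘ exceeds (toℕ j))) ,
    λ i → ThresholdsSeparate⇒Enclosing (coordX≤m m x i) (coordX≤m m y i)
            (λ j differ → Enclosing-bits⇒≢ m differ (enc (i , j) (differ ∘ bit-injective m)))
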